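{- Let $B=(X,Y,E_B)$ be a bipartite graph and let $T=(X,E_T)$ be a star such that, for each $y\in Y$, $N(y)$ induces a subtree of $T$. Then (i) $B^2[X]$ has at most one big connected component, and the big connected component (if it exists) has a universal vertex; (ii) $B^2[Y]$ is obtained from a split graph by substituting vertices by cliques.
   Context: The half-square $B^2[X]$ is the graph on $X$ where two distinct vertices are adjacent iff they have a common neighbor in $Y$; $B^2[Y]$ is defined symmetrically. A connected component is big if it has at least two vertices; a universal vertex of a graph is adjacent to all other vertices of it. A split graph is a graph whose vertex set can be partitioned into a clique and a stable set. Substituting a vertex $v$ of a graph $G$ by a graph $H$ yields the graph obtained from $G-v$ and $H$ by adding all edges between $N_G(v)$ and $V(H)$; "substituting vertices by cliques" means substituting some vertices, each by a nonempty complete graph. -}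

module Defs where

open import Data.Nat using (ℕ)
open import Data.Fin using (Fin)
open import Data.Bool using (Bool; true; false)
open import Data.Product using (Σ; ∃; ∃-syntax; _×_; _,_)
open import Data.Sum using (_⊎_)
open import Relation.Binary.PropositionalEquality using (_≡_; _≢_)
open import Relation.Nullary using (¬_)

-- A bipartite graph B = (X, Y, E_B) with X = Fin n, Y = Fin m;
-- x ∈ X and y ∈ Y are adjacent iff E x y ≡ true.
Bipartite : ℕ → ℕ → Set
Bipartite n m = Fin n → Fin m → Bool

Symmetric : {k : ℕ} → (Fin k → Fin k → Bool) → Set
Symmetric {k} A = ∀ (u v : Fin k) → A u v ≡ A v u

Irreflexive : {k : ℕ} → (Fin k → Fin k → Bool) → Set
Irreflexive {k} A = ∀ (u : Fin k) → A u u ≡ false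

IsGraph : {k : ℕ} → (Fin k → Fin k → Bool) → Set
IsGraph A = Symmetric A × Irreflexive A

IsStar : {n : ℕ} → (Fin n → Fin n → Bool) → Set
IsStar {n} T = Σ (Fin n) λ c → ∀ (x z : Fin n) →
  (T x z ≡ true → x ≢ z × (x ≡ c ⊎ z ≡ c)) ×
  (x ≢ z × (x ≡ c ⊎ z ≡ c) → T x z ≡ true)

data WalkIn {A : Set} (R : A → A → Set) (S : A → Set) : A → A → Set where
  here : ∀ {x} → S x → WalkIn R S x x
  step : ∀ {x z y} → S x → R x z → WalkIn R S z y → WalkIn R S x y

data Reach {A : Set} (R : A → A → Set) : A → A → Set where
  here : ∀ {x} → Reach R x x
  step : ∀ {x z y} → R x z → Reach R z y → Reach R x y

N : {n m : ℕ} → Bipartite n m → Fin m → Fin n → Set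
N E y x = E x y ≡ true

-- S ⊆ V(T) induces a subtree of the tree T: S is nonempty and T[S] is
-- connected (acyclicity of T[S] is automatic since T is a tree).
InducesSubtree : {n : ℕ} → (Fin n → Fin n → Bool) → (Fin n → Set) → Set
InducesSubtree {n} T S =
  (∃[ x ] S x) ×
  (∀ (x z : Fin n) → S x → S z → WalkIn (λ a b → T a b ≡ true) S x z)

HalfSqX : {n m : ℕ} → Bipartite n m → Fin n → Fin n → Set
HalfSqX {n} {m} E x x' = x ≢ x' × ∃[ y ] (E x y ≡ true × E x' y ≡ true)

HalfSqY : {n m : ℕ} → Bipartite n m → Fin m → Fin m → Set
HalfSqY {n} {m} E y y' = y ≢ y' × ∃[ x ] (E x y ≡ true × E x y' ≡ true)

InBigComponent : {A : Set} → (A → A → Set) → A → Set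
InBigComponent {A} R x = ∃[ x' ] (x' ≢ x × Reach R x x')

AtMostOneBigWithUniversal : {A : Set} → (A → A → Set) → Set
AtMostOneBigWithUniversal {A} R =
  (∀ (x x' : A) → InBigComponent R x → InBigComponent R x' → Reach R x x') ×
  (∀ (x : A) → InBigComponent R x →
     ∃[ u ] (Reach R x u × (∀ (v : A) → Reach R x v → v ≢ u → R u v)))

IsSplit : {k : ℕ} → (Fin k → Fin k → Bool) → Set
IsSplit {k} H = Σ (Fin k → Bool) λ p →
  (∀ (u v : Fin k) → p u ≡ true → p v ≡ true → u ≢ v → H u v ≡ true) ×
  (∀ (u v : Fin k) → p u ≡ false → p v ≡ false → H u v ≡ false)

-- The graph G (on Fin m, adjacency R) is obtained from the graph H on
-- Fin k by substituting every vertex v of H by a nonempty clique (of size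
-- |f⁻¹(v)|; size 1 = not substituted): f is surjective and distinct
-- vertices are adjacent iff they lie in the same clique or their images
-- are adjacent in H.
SubstCliques : {m k : ℕ} → (Fin m → Fin m → Set) → (Fin k → Fin k → Bool) → Set
SubstCliques {m} {k} R H = Σ (Fin m → Fin k) λ f →
  (∀ (v : Fin k) → ∃[ y ] (f y ≡ v)) ×
  (∀ (y y' : Fin m) → y ≢ y' →
     (R y y' → f y ≡ f y' ⊎ H (f y) (f y') ≡ true) ×
     (f y ≡ f y' ⊎ H (f y) (f y') ≡ true → R y y'))

ObtainedFromSplitBySubstitutingCliques : {m : ℕ} → (Fin m → Fin m → Set) → Set
ObtainedFromSplitBySubstitutingCliques R =
  ∃[ k ] Σ (Fin k → Fin k → Bool) λ H →
    IsGraph H × IsSplit H × SubstCliques R H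

module Submission where

-- Let c be the centre of the star T.  Every edge of a star is incident to c,
-- so a subtree of T with two distinct vertices contains c: the first edge of
-- a walk between them ends in c or starts there (centreInSubtree).  Hence c
-- "covers" B: any two distinct neighbours of some y ∈ Y force c ∈ N(y), and
-- every y with c ∉ N(y) has a single neighbour.
--
-- (i)  Covering makes c a hub of B²[X]: every vertex ≠ c incident to an edge
--      is adjacent to c.  A general graph fact (hubbedGraph) then gives at
--      most one big component, in which the hub is universal.
-- (ii) In B²[Y] the vertices y with c ∈ N(y) are pairwise adjacent, and two
--      vertices with c ∉ N(·) sharing a neighbour are twins.  A general fact
--      (SplitSubstitution) contracts the twin classes, using a quotient of
--      Fin m by a decidable equivalence (quotient), into a split graph from
--      which the original graph arises by substituting cliques.

open import Defs
open import Data.Nat using (ℕ; zero; suc)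
open import Data.Fin using (Fin; zero; suc; _≟_)
open import Data.Fin.Properties using (any?; suc-injective)
open import Data.Bool using (Bool; true; false)
open import Data.Bool.Properties using () renaming (_≟_ to _≟ᵇ_)
open import Data.Product using (_×_; _,_; ∃-syntax; proj₁; proj₂)
open import Data.Sum using (_⊎_; inj₁; inj₂)
open import Data.Empty using (⊥-elim)
open import Function.Bundles using (mk⇔)
open import Relation.Nullary using (¬_; Dec; yes; no; does; ¬?; _×-dec_; _⊎-dec_)
open import Relation.Nullary.Decidable using (dec-true; dec-false; does-⇔)
open import Relation.Binary.Structures using (IsDecEquivalence)
open import Relation.Binary.PropositionalEquality
  using (_≡_; _≢_; refl; sym; trans; cong)

record Quotient {m : ℕ} (Q : Fin m → Fin m → Set) : Set where
  field
    size      : ℕ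
    class     : Fin m → Fin size
    rep       : Fin size → Fin m
    class-rep : ∀ v → class (rep v) ≡ v
    sound     : ∀ a b → class a ≡ class b → Q a b
    complete  : ∀ a b → Q a b → class a ≡ class b

restrict : ∀ {m} {Q : Fin (suc m) → Fin (suc m) → Set} →
  IsDecEquivalence Q → IsDecEquivalence (λ a b → Q (suc a) (suc b))
restrict eq = record
  { isEquivalence = record { refl = refl′ ; sym = sym′ ; trans = trans′ }
  ; _≟_ = λ a b → suc a ≟′ suc b
  }
  where
  open IsDecEquivalence eq
    renaming (refl to refl′; sym to sym′; trans to trans′; _≟_ to _≟′_)

module Extend {m : ℕ} {Q : Fin (suc m) → Fin (suc m) → Set}
  (eq : IsDecEquivalence Q) (q : Quotient (λ a b → Q (suc a) (suc b))) where
  open IsDecEquivalence eq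
    renaming (refl to ~-refl; sym to ~-sym; trans to ~-trans)
  open Quotient q

  join : (j : Fin m) → Q zero (suc j) → Quotient Q
  join j 0~j = record
    { size = size ; class = cls ; rep = λ v → suc (rep v)
    ; class-rep = class-rep ; sound = snd ; complete = cmp }
    where
    cls : Fin (suc m) → Fin size
    cls zero    = class j
    cls (suc i) = class i
    snd : ∀ a b → cls a ≡ cls b → Q a b
    snd zero    zero    _ = ~-refl
    snd zero    (suc i) e = ~-trans 0~j (sound j i e)
    snd (suc i) zero    e = ~-sym (~-trans 0~j (sound j i (sym e)))
    snd (suc i) (suc i′) e = sound i i′ e
    cmp : ∀ a b → Q a b → cls a ≡ cls b
    cmp zero    zero    _ = refl
    cmp zero    (suc i) r = complete j i (~-trans (~-sym 0~j) r)
    cmp (suc i) zero    r = sym (complete j i (~-trans (~-sym 0~j) (~-sym r)))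
    cmp (suc i) (suc i′) r = complete i i′ r

  fresh : ¬ (∃[ j ] Q zero (suc j)) → Quotient Q
  fresh isolated = record
    { size = suc size ; class = cls ; rep = rp
    ; class-rep = cls-rp ; sound = snd ; complete = cmp }
    where
    cls : Fin (suc m) → Fin (suc size)
    cls zero    = zero
    cls (suc i) = suc (class i)
    rp : Fin (suc size) → Fin (suc m)
    rp zero    = zero
    rp (suc v) = suc (rep v)
    cls-rp : ∀ v → cls (rp v) ≡ v
    cls-rp zero    = refl
    cls-rp (suc v) = cong suc (class-rep v)
    snd : ∀ a b → cls a ≡ cls b → Q a b
    snd zero    zero    _ = ~-refl
    snd (suc i) (suc i′) e = sound i i′ (suc-injective e)
    cmp : ∀ a b → Q a b → cls a ≡ cls b
    cmp zero    zero    _ = refl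
    cmp zero    (suc i) r = ⊥-elim (isolated (i , r))
    cmp (suc i) zero    r = ⊥-elim (isolated (i , ~-sym r))
    cmp (suc i) (suc i′) r = cong suc (complete i i′ r)

quotient : ∀ {m} {Q : Fin m → Fin m → Set} → IsDecEquivalence Q → Quotient Q
quotient {zero} _ = record
  { size = zero ; class = λ () ; rep = λ () ; class-rep = λ ()
  ; sound = λ () ; complete = λ () }
quotient {suc m} eq with any? (λ j → IsDecEquivalence._≟_ eq zero (suc j))
... | yes (j , 0~j) = Extend.join  eq (quotient (restrict eq)) j 0~j
... | no isolated   = Extend.fresh eq (quotient (restrict eq)) isolated

_++_ : ∀ {A : Set} {R : A → A → Set} {a b d} → Reach R a b → Reach R b d → Reach R a d
here       ++ q = q
step r p   ++ q = step r (p ++ q)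

reverse : ∀ {A : Set} {R : A → A → Set} → (∀ {a b} → R a b → R b a) →
  ∀ {a b} → Reach R a b → Reach R b a
reverse R-sym here       = here
reverse R-sym (step r p) = reverse R-sym p ++ step (R-sym r) here

hubbedGraph : {A : Set} (R : A → A → Set) → (∀ {a b} → R a b → R b a) →
  (c : A) → (∀ {a b} → R a b → a ≡ c ⊎ R c a) →
  AtMostOneBigWithUniversal R
hubbedGraph R R-sym c hub =
  (λ x x′ bx bx′ → toHub bx ++ reverse R-sym (toHub bx′)) ,
  (λ x bx → c , toHub bx , λ v p v≢c → universal bx p v≢c)
  where
  nearHub : ∀ {x} → InBigComponent R x → x ≡ c ⊎ R c x
  nearHub (_ , x′≢x , here)     = ⊥-elim (x′≢x refl)
  nearHub (_ , _    , step r _) = hub r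

  reached : ∀ {x v} → Reach R x v → v ≡ x ⊎ (v ≡ c ⊎ R c v)
  reached here = inj₁ refl
  reached (step r p) with reached p
  ... | inj₁ refl = inj₂ (hub (R-sym r))
  ... | inj₂ near = inj₂ near

  toHub : ∀ {x} → InBigComponent R x → Reach R x c
  toHub bx with nearHub bx
  ... | inj₁ refl = here
  ... | inj₂ r    = step (R-sym r) here

  universal : ∀ {x v} → InBigComponent R x → Reach R x v → v ≢ c → R c v
  universal bx p v≢c with reached p
  ... | inj₂ (inj₁ v≡c) = ⊥-elim (v≢c v≡c)
  ... | inj₂ (inj₂ r)   = r
  ... | inj₁ refl with nearHub bx
  ...   | inj₁ v≡c = ⊥-elim (v≢c v≡c)
  ...   | inj₂ r   = r

witness : {P : Set} (d : Dec P) → does d ≡ true → P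
witness (yes p) _ = p
witness (no _) ()

module SplitSubstitution {m : ℕ} (S : Fin m → Fin m → Set)
  (S? : ∀ a b → Dec (S a b)) (S-sym : ∀ {a b} → S a b → S b a)
  (p : Fin m → Bool)
  (core : ∀ {a b} → p a ≡ true → p b ≡ true → S a b)
  (twins : ∀ {a a′ b} → p a ≡ false → S a a′ → S a b → S a′ b) where

  Twin : Fin m → Fin m → Set
  Twin a b = a ≡ b ⊎ (p a ≡ false × p b ≡ false × S a b)

  -- Transitivity is where twins is needed: a–b–d through a p-false b.
  twin-trans : ∀ {a b d} → Twin a b → Twin b d → Twin a d
  twin-trans (inj₁ refl) t = t
  twin-trans t (inj₁ refl) = t
  twin-trans (inj₂ (pa , pb , sab)) (inj₂ (_ , pd , sbd)) =
    inj₂ (pa , pd , twins pb (S-sym sab) sbd)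

  twin-isDecEquivalence : IsDecEquivalence Twin
  twin-isDecEquivalence = record
    { isEquivalence = record
      { refl  = inj₁ refl
      ; sym   = λ { (inj₁ refl) → inj₁ refl
                  ; (inj₂ (pa , pb , sab)) → inj₂ (pb , pa , S-sym sab) }
      ; trans = twin-trans }
    ; _≟_ = λ a b → (a ≟ b) ⊎-dec ((p a ≟ᵇ false) ×-dec (p b ≟ᵇ false) ×-dec S? a b)
    }

  twin-respectsˡ : ∀ {a a′ b} → Twin a a′ → S a b → S a′ b
  twin-respectsˡ (inj₁ refl)            sab = sab
  twin-respectsˡ (inj₂ (pa , _ , saa′)) sab = twins pa saa′ sab

  twin-respects : ∀ {a a′ b b′} → Twin a a′ → Twin b b′ → S a b → S a′ b′
  twin-respects ta tb sab = S-sym (twin-respectsˡ tb (S-sym (twin-respectsˡ ta sab)))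

  open Quotient (quotient twin-isDecEquivalence)

  Adjacent : Fin size → Fin size → Set
  Adjacent v w = v ≢ w × S (rep v) (rep w)

  adjacent? : ∀ v w → Dec (Adjacent v w)
  adjacent? v w = ¬? (v ≟ w) ×-dec S? (rep v) (rep w)

  H : Fin size → Fin size → Bool
  H v w = does (adjacent? v w)

  twin-rep : ∀ y → Twin y (rep (class y))
  twin-rep y = sound _ _ (sym (class-rep (class y)))

  twin-rep⁻¹ : ∀ y → Twin (rep (class y)) y
  twin-rep⁻¹ y = IsDecEquivalence.sym twin-isDecEquivalence (twin-rep y)

  H-intro : ∀ {y y′} → class y ≢ class y′ → S y y′ → H (class y) (class y′) ≡ true
  H-intro {y} {y′} ne s =
    dec-true (adjacent? (class y) (class y′))
             (ne , twin-respects (twin-rep y) (twin-rep y′) s)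

  H-elim : ∀ {y y′} → H (class y) (class y′) ≡ true → S y y′
  H-elim {y} {y′} h = twin-respects (twin-rep⁻¹ y) (twin-rep⁻¹ y′) (proj₂ (witness (adjacent? (class y) (class y′)) h))

  isGraph : IsGraph H
  isGraph = (λ v w → does-⇔ (mk⇔ swap swap) (adjacent? v w) (adjacent? w v)) ,
            (λ v → dec-false (adjacent? v v) (λ (ne , _) → ne refl))
    where
    swap : ∀ {v w} → Adjacent v w → Adjacent w v
    swap (ne , s) = (λ e → ne (sym e)) , S-sym s

  isSplit : IsSplit H
  isSplit = (λ v → p (rep v)) , clique , stable
    where
    clique : ∀ u v → p (rep u) ≡ true → p (rep v) ≡ true → u ≢ v → H u v ≡ true
    clique u v pu pv ne = dec-true (adjacent? u v) (ne , core pu pv)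
    -- S-related p-false representatives are twins, hence the same class.
    stable : ∀ u v → p (rep u) ≡ false → p (rep v) ≡ false → H u v ≡ false
    stable u v pu pv = dec-false (adjacent? u v) λ (ne , s) →
      ne (trans (sym (class-rep u))
         (trans (complete _ _ (inj₂ (pu , pv , s))) (class-rep v)))

  substCliques : SubstCliques (λ y y′ → y ≢ y′ × S y y′) H
  substCliques = class , (λ v → rep v , class-rep v) ,
                 λ y y′ ne → adjacent⇒ ne , ⇒adjacent ne
    where
    adjacent⇒ : ∀ {y y′} → y ≢ y′ → y ≢ y′ × S y y′ →
      class y ≡ class y′ ⊎ H (class y) (class y′) ≡ true
    adjacent⇒ {y} {y′} _ (_ , s) = classify (class y ≟ class y′)
      where
      classify : Dec (class y ≡ class y′) →
        class y ≡ class y′ ⊎ H (class y) (class y′) ≡ true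
      classify (yes same) = inj₁ same
      classify (no  diff) = inj₂ (H-intro {y} {y′} diff s)
    ⇒adjacent : ∀ {y y′} → y ≢ y′ →
      class y ≡ class y′ ⊎ H (class y) (class y′) ≡ true → y ≢ y′ × S y y′
    ⇒adjacent {y} {y′} ne (inj₁ same) with sound y y′ same
    ... | inj₁ e              = ⊥-elim (ne e)
    ... | inj₂ (_ , _ , s)    = ne , s
    ⇒adjacent {y} {y′} ne (inj₂ h) = ne , H-elim {y} {y′} h

  obtained : ObtainedFromSplitBySubstitutingCliques (λ y y′ → y ≢ y′ × S y y′)
  obtained = size , H , isGraph , isSplit , substCliques

walkStart : ∀ {A : Set} {R : A → A → Set} {S : A → Set} {a b} → WalkIn R S a b → S a
walkStart (here s)     = s
walkStart (step s _ _) = s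

-- In a tree all of whose edges touch c, a connected vertex set with two
-- distinct vertices contains c: the first edge of a walk between them lies
-- in the set and touches c.
centreInSubtree : ∀ {n} {T : Fin n → Fin n → Bool} {c : Fin n} →
  (∀ {x z} → T x z ≡ true → x ≡ c ⊎ z ≡ c) →
  ∀ {S : Fin n → Set} → InducesSubtree T S →
  ∀ {x z} → S x → S z → x ≢ z → S c
centreInSubtree atCentre (_ , connected) {x} {z} sx sz x≢z with connected x z sx sz
... | here _ = ⊥-elim (x≢z refl)
... | step sx′ t w with atCentre t
...   | inj₁ refl = sx′
...   | inj₂ refl = walkStart w

Covers : ∀ {n m} → Bipartite n m → Fin n → Set
Covers E c = ∀ {x z y} → E x y ≡ true → E z y ≡ true → x ≢ z → E c y ≡ true

uniqueNeighbour : ∀ {n m} {E : Bipartite n m} {c} → Covers E c →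
  ∀ {x z y} → E c y ≡ false → E x y ≡ true → E z y ≡ true → x ≡ z
uniqueNeighbour covers {x} {z} cy xy zy with x ≟ z
... | yes x≡z = x≡z
... | no  x≢z with trans (sym (covers xy zy x≢z)) cy
...   | ()

coverHub : ∀ {n m} {E : Bipartite n m} {c} → Covers E c →
  ∀ {a b} → HalfSqX E a b → a ≡ c ⊎ HalfSqX E c a
coverHub {c = c} covers {a} (a≢b , y , ay , by) with a ≟ c
... | yes a≡c = inj₁ a≡c
... | no  a≢c = inj₂ ((λ e → a≢c (sym e)) , y , covers ay by a≢b , ay)

halfSqX-sym : ∀ {n m} {E : Bipartite n m} {a b} → HalfSqX E a b → HalfSqX E b a
halfSqX-sym (a≢b , y , ay , by) = (λ e → a≢b (sym e)) , y , by , ay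

-- Vertices of Y with a common neighbour (B²[Y] with loops allowed).
Common : ∀ {n m} → Bipartite n m → Fin m → Fin m → Set
Common E y y′ = ∃[ x ] (E x y ≡ true × E x y′ ≡ true)

common? : ∀ {n m} (E : Bipartite n m) → ∀ y y′ → Dec (Common E y y′)
common? E y y′ = any? (λ x → (E x y ≟ᵇ true) ×-dec (E x y′ ≟ᵇ true))

common-sym : ∀ {n m} {E : Bipartite n m} {y y′} → Common E y y′ → Common E y′ y
common-sym (x , p , q) = x , q , p

-- If c covers B, the vertices of Y not adjacent to c are twins in B²[Y]
-- as soon as they share a neighbour: both have that vertex as their only one.
coverTwins : ∀ {n m} {E : Bipartite n m} {c} → Covers E c →
  ∀ {a a′ b} → E c a ≡ false → Common E a a′ → Common E a b → Common E a′ b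
coverTwins {E = E} covers ca (x , ax , a′x) (x′ , ax′ , bx′)
  with uniqueNeighbour {E = E} covers ca ax ax′
... | refl = x , a′x , bx′

lemma1 : (n m : ℕ) (E : Bipartite n m) (T : Fin n → Fin n → Bool) →
    IsStar T →
    (∀ (y : Fin m) → InducesSubtree T (N E y)) →
    AtMostOneBigWithUniversal (HalfSqX E) ×
    ObtainedFromSplitBySubstitutingCliques (HalfSqY E)
lemma1 n m E T (c , star) subtree =
  hubbedGraph (HalfSqX E) (halfSqX-sym {E = E}) c (coverHub {E = E} covers) ,
  SplitSubstitution.obtained (Common E) (common? E) (common-sym {E = E})
    (λ y → E c y) (λ cy cy′ → c , cy , cy′) (coverTwins {E = E} covers)
  where
  -- Every edge of the star touches c, so c lies in each N(y) with two
  -- distinct elements.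
  covers : Covers E c
  covers {y = y} = centreInSubtree (λ t → proj₂ (proj₁ (star _ _) t)) (subtree y)
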